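{- Let $\mathscr G$ be a non-deterministic functor, $\mathscr F$ an ingredient of $\mathscr G$ ($\mathscr F\lhd\mathscr G$), $\mathcal R\subseteq\mathsf{Exp}_{\mathscr G}\times\mathsf{Exp}_{\mathscr G}$ a binary relation on the set of $\mathscr G$-expressions, and $\sigma,\sigma'\in\mathscr F(\mathsf{Exp}_{\mathscr G})$. (a) If $\mathscr G$ is not a constant functor, then $(\sigma,\sigma')\in\overline{\mathscr F}(cl(\mathcal R_{id}))$ if and only if $\mathcal E_{\mathscr G}\cup\langle\mathcal R\rangle\vdash_{NDF}\langle\sigma\rangle=\langle\sigma'\rangle$. (b) If $\mathscr G$ is a constant functor $\mathsf B$, then $(\sigma,\sigma')\in\overline{\mathsf B}(cl(\mathcal R_{id}))$ if and only if $\mathcal E_{\mathscr G}\vdash_{NDF}\langle\sigma\rangle=\langle\sigma'\rangle$.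
   Context: Non-deterministic functors $\mathscr{G}:\mathbf{Set}\to\mathbf{Set}$ are generated by $\mathscr{G}::= Id \mid \mathsf{B}\mid \mathscr{G}\,\hat{+}\,\mathscr{G}\mid \mathscr{G}\times\mathscr{G}\mid \mathscr{G}^A\mid \mathcal{P}_\omega\mathscr{G}$, where $\mathsf{B}$ is a finite join-semilattice (join $\vee$, bottom $\bot_{\mathsf B}$), $A$ a finite set, $\mathcal{P}_\omega$ the finite powerset functor, and $X\,\hat{+}\,Y=X\uplus Y\uplus\{\bot,\top\}$ (injections $\kappa_1,\kappa_2$; on maps, $f_1\hat+f_2$ fixes $\bot,\top$ and sends $\kappa_i(x)$ to $\kappa_i(f_i(x))$). A functor is constant if it is a semilattice $\mathsf B$. The ingredient relation $\lhd$ is the least reflexive and transitive relation with $\mathscr{G}_i\lhd\mathscr{G}_1\times\mathscr{G}_2$, $\mathscr{G}_i\lhd\mathscr{G}_1\hat{+}\mathscr{G}_2$ ($i=1,2$), $\mathscr{G}\lhd\mathscr{G}^A$, $\mathscr{G}\lhd\mathcal{P}_\omega\mathscr{G}$. For a functor $\mathscr F$ and a relation $R\subseteq X\times X$, the lifting is $\overline{\mathscr F}(R)=\{(\mathscr F(\pi_1)(z),\mathscr F(\pi_2)(z))\mid z\in\mathscr F(R)\}$. Expressions: $\varepsilon::= x\mid\varepsilon\oplus\varepsilon\mid\gamma$, $\gamma::=\emptyset\mid\gamma\oplus\gamma\mid\mu x.\gamma\mid b\mid l\langle\varepsilon\rangle\mid r\langle\varepsilon\rangle\mid l[\varepsilon]\mid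 r[\varepsilon]\mid a(\varepsilon)\mid\{\varepsilon\}$ ($x$ fixed-point variables, $b\in\mathsf B$, $a\in A$). Typing $\vdash\varepsilon:\mathscr F\lhd\mathscr G$ is the least relation with: $\emptyset:\mathscr F\lhd\mathscr G$; $b:\mathsf B\lhd\mathscr G$; $x:\mathscr G\lhd\mathscr G$; $\mu x.\varepsilon:\mathscr G\lhd\mathscr G$ if $\varepsilon:\mathscr G\lhd\mathscr G$; $\varepsilon_1\oplus\varepsilon_2:\mathscr F\lhd\mathscr G$ if both $\varepsilon_i:\mathscr F\lhd\mathscr G$; $\varepsilon:Id\lhd\mathscr G$ if $\varepsilon:\mathscr G\lhd\mathscr G$; $l\langle\varepsilon\rangle$ (resp. $r\langle\varepsilon\rangle$) $:\mathscr F_1\times\mathscr F_2\lhd\mathscr G$ if $\varepsilon:\mathscr F_1\lhd\mathscr G$ (resp. $\mathscr F_2$); $l[\varepsilon]$ (resp. $r[\varepsilon]$) $:\mathscr F_1\hat+\mathscr F_2\lhd\mathscr G$ if $\varepsilon:\mathscr F_1\lhd\mathscr G$ (resp. $\mathscr F_2$); $a(\varepsilon):\mathscr F^A\lhd\mathscr G$ if $\varepsilon:\mathscr F\lhd\mathscr G$; $\{\varepsilon\}:\mathcal P_\omega\mathscr F\lhd\mathscr G$ if $\varepsilon:\mathscr F\lhd\mathscr G$. $\mathsf{Exp}_{\mathscr G}$ is the set of closed expressions of type $\mathscr G\lhd\mathscr G$. Algebraic setting: $\mathcal E_{\mathscr G}$ is an equational specification whose terms include expressions (sort $\mathsf{Exp}$)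 and structured expressions $\sigma::=\varepsilon\mid b\mid\langle\sigma,\sigma\rangle\mid k_1(\sigma)\mid k_2(\sigma)\mid\bot\mid\top\mid\lambda.(a,\mathscr F\lhd\mathscr G,\sigma)\mid\{\sigma_1,\dots,\sigma_n\}$ (sort $\mathsf{ExpStruct}$; $\lambda.(a,\mathscr F\lhd\mathscr G,\sigma)$ denotes the function $A\to\mathscr F(\mathsf{Exp}_{\mathscr G})$ sending $a$ to $\sigma$ and every other letter to the empty structured expression of type $\mathscr F$), and whose equations define semilattice joins, substitution, typing and the coalgebra map on expressions; these equations serve only to reduce defined operations, and elements of $\mathscr F(\mathsf{Exp}_{\mathscr G})$ are identified with the corresponding reduced structured-expression terms (elements of $Id(\mathsf{Exp}_{\mathscr G})$ are expressions, of $\mathsf B$ semilattice constants, of products pairs, of $\hat+$ the terms $k_1(\sigma),k_2(\sigma),\bot,\top$, of $\mathcal P_\omega$ finite sets). A fresh sort $\mathsf{Frozen}$ and a freezing operator $\langle-\rangle:s\to\mathsf{Frozen}$ for each sort $s$ are added (no other operations take arguments of sort $\mathsf{Frozen}$). For $\mathcal R\subseteq\mathsf{Exp}_{\mathscr G}\times\mathsf{Exp}_{\mathscr G}$, $\mathcal E_{\mathscr G}\cup\langle\mathcal R\rangle$ denotes $\mathcal E_{\mathscr G}$ with the extra equations $\langle\varepsilon\rangle=\langle\varepsilon'\rangle$ for $(\varepsilon,\varepsilon')\in\mathcal R$. $\vdash$ is ordinary equational deduction (reflexivity, symmetry, transitivity, congruence, substitutivity), and $\vdash_{NDF}$ is $\vdash$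 extended with the rules: from $\langle\sigma_1\rangle=\langle\sigma_1'\rangle$ and $\langle\sigma_2\rangle=\langle\sigma_2'\rangle$ infer $\langle\langle\sigma_1,\sigma_2\rangle\rangle=\langle\langle\sigma_1',\sigma_2'\rangle\rangle$; from $\langle\sigma\rangle=\langle\sigma'\rangle$ infer $\langle k_i(\sigma)\rangle=\langle k_i(\sigma')\rangle$ ($i=1,2$); from $\langle f(a)\rangle=\langle g(a)\rangle$ for all $a\in A$ infer $\langle f\rangle=\langle g\rangle$; from $\langle\sigma_{i_l}\rangle=\langle\sigma'_{j_l}\rangle$ ($l=1,\dots,k$) with $\{i_1,\dots,i_k\}=\{1,\dots,n\}$ and $\{j_1,\dots,j_k\}=\{1,\dots,m\}$ infer $\langle\{\sigma_1,\dots,\sigma_n\}\rangle=\langle\{\sigma_1',\dots,\sigma_m'\}\rangle$. $\mathcal R_{id}=\mathcal R\cup\{(\varepsilon,\varepsilon)\mid\varepsilon\in\mathsf{Exp}_{\mathscr G}\}$, and $cl(\cdot)$ denotes the reflexive, symmetric, transitive closure. -}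

module Defs where

open import Data.Nat using (ℕ)
open import Data.Fin using (Fin)
open import Data.List using (List; []; _∷_; map; length; lookup)
open import Data.List.Relation.Unary.Any using (Any)
open import Data.List.Relation.Unary.All using (All)
open import Data.Product using (Σ; _×_; _,_; proj₁; proj₂; ∃)
open import Data.Empty using (⊥)
open import Data.Unit using (⊤)
open import Relation.Binary.PropositionalEquality using (_≡_)

-- Finite join-semilattices (carrier Fin size, up to isomorphism)

record FinSL : Set where
  field
    size  : ℕ
    _∨_   : Fin size → Fin size → Fin size
    ⊥B    : Fin size
    ∨-assoc : ∀ x y z → ((x ∨ y) ∨ z) ≡ (x ∨ (y ∨ z))
    ∨-comm  : ∀ x y → (x ∨ y) ≡ (y ∨ x)
    ∨-idem  : ∀ x → (x ∨ x) ≡ x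
    ∨-identityˡ : ∀ x → (⊥B ∨ x) ≡ x

open FinSL public using (size)

-- Non-deterministic functors (the finite alphabet A is Fin n)

infixr 6 _+̂_
infixr 7 _⊠_
infixl 8 _^F_

data NDF : Set where
  Id   : NDF
  B    : FinSL → NDF
  _+̂_  : NDF → NDF → NDF
  _⊠_  : NDF → NDF → NDF
  _^F_ : NDF → ℕ → NDF
  𝒫    : NDF → NDF

IsConstant : NDF → Set
IsConstant G = Σ FinSL (λ L → G ≡ B L)

infix 4 _◁_
data _◁_ : NDF → NDF → Set where
  ◁-refl  : ∀ {F} → F ◁ F
  ◁-trans : ∀ {F G H} → F ◁ G → G ◁ H → F ◁ H
  ◁-⊠₁    : ∀ {F₁ F₂} → F₁ ◁ F₁ ⊠ F₂
  ◁-⊠₂    : ∀ {F₁ F₂} → F₂ ◁ F₁ ⊠ F₂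
  ◁-+̂₁    : ∀ {F₁ F₂} → F₁ ◁ F₁ +̂ F₂
  ◁-+̂₂    : ∀ {F₁ F₂} → F₂ ◁ F₁ +̂ F₂
  ◁-^     : ∀ {F n} → F ◁ F ^F n
  ◁-𝒫     : ∀ {F} → F ◁ 𝒫 F

data Hat (X Y : Set) : Set where
  κ₁ : X → Hat X Y
  κ₂ : Y → Hat X Y
  ⊥̂  : Hat X Y
  ⊤̂  : Hat X Y

⟦_⟧ : NDF → Set → Set
⟦ Id ⟧ X     = X
⟦ B L ⟧ X    = Fin (size L)
⟦ F +̂ G ⟧ X  = Hat (⟦ F ⟧ X) (⟦ G ⟧ X)
⟦ F ⊠ G ⟧ X  = ⟦ F ⟧ X × ⟦ G ⟧ X
⟦ F ^F n ⟧ X = Fin n → ⟦ F ⟧ X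
⟦ 𝒫 F ⟧ X    = List (⟦ F ⟧ X)   -- finite subsets, represented by lists

mapF : (F : NDF) {X Y : Set} → (X → Y) → ⟦ F ⟧ X → ⟦ F ⟧ Y
mapF Id f x = f x
mapF (B L) f b = b
mapF (F +̂ G) f (κ₁ x) = κ₁ (mapF F f x)
mapF (F +̂ G) f (κ₂ y) = κ₂ (mapF G f y)
mapF (F +̂ G) f ⊥̂ = ⊥̂
mapF (F +̂ G) f ⊤̂ = ⊤̂
mapF (F ⊠ G) f (x , y) = mapF F f x , mapF G f y
mapF (F ^F n) f g = λ a → mapF F f (g a)
mapF (𝒫 F) f [] = []
mapF (𝒫 F) f (x ∷ xs) = mapF F f x ∷ mapF (𝒫 F) f xs

EqF : (F : NDF) {X : Set} → ⟦ F ⟧ X → ⟦ F ⟧ X → Set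
EqF Id x y = x ≡ y
EqF (B L) x y = x ≡ y
EqF (F +̂ G) (κ₁ x) (κ₁ y) = EqF F x y
EqF (F +̂ G) (κ₂ x) (κ₂ y) = EqF G x y
EqF (F +̂ G) ⊥̂ ⊥̂ = ⊤
EqF (F +̂ G) ⊤̂ ⊤̂ = ⊤
EqF (F +̂ G) _ _ = ⊥
EqF (F ⊠ G) (x₁ , x₂) (y₁ , y₂) = EqF F x₁ y₁ × EqF G x₂ y₂
EqF (F ^F n) f g = ∀ a → EqF F (f a) (g a)
EqF (𝒫 F) xs ys =
  All (λ x → Any (λ y → EqF F x y) ys) xs × All (λ y → Any (λ x → EqF F x y) xs) ys

-- σ ∈ F(P) for a subset P ⊆ X
AllF : (F : NDF) {X : Set} → (X → Set) → ⟦ F ⟧ X → Set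
AllF Id P x = P x
AllF (B L) P b = ⊤
AllF (F +̂ G) P (κ₁ x) = AllF F P x
AllF (F +̂ G) P (κ₂ y) = AllF G P y
AllF (F +̂ G) P ⊥̂ = ⊤
AllF (F +̂ G) P ⊤̂ = ⊤
AllF (F ⊠ G) P (x , y) = AllF F P x × AllF G P y
AllF (F ^F n) P g = ∀ a → AllF F P (g a)
AllF (𝒫 F) P xs = All (AllF F P) xs

-- Relation lifting: F̄(R) = {(F(π₁)(z), F(π₂)(z)) | z ∈ F(R)}
Lifting : (F : NDF) {X : Set} → (X → X → Set) → ⟦ F ⟧ X → ⟦ F ⟧ X → Set
Lifting F {X} R σ σ' =
  Σ (⟦ F ⟧ (Σ (X × X) (λ p → R (proj₁ p) (proj₂ p)))) λ z →
    EqF F (mapF F (λ p → proj₁ (proj₁ p)) z) σ ×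
    EqF F (mapF F (λ p → proj₂ (proj₁ p)) z) σ'

Var : Set
Var = ℕ

data Exp : Set where
  var  : Var → Exp
  _⊕_  : Exp → Exp → Exp
  ∅    : Exp
  μ_∙_ : Var → Exp → Exp
  lit  : (L : FinSL) → Fin (size L) → Exp
  l⟨_⟩ : Exp → Exp
  r⟨_⟩ : Exp → Exp
  l[_] : Exp → Exp
  r[_] : Exp → Exp
  app  : {n : ℕ} → Fin n → Exp → Exp
  ⟪_⟫  : Exp → Exp

Guarded : Exp → Set
Guarded (var x) = ⊥
Guarded (e₁ ⊕ e₂) = Guarded e₁ × Guarded e₂
Guarded _ = ⊤

WF : Exp → Set
WF (var x) = ⊤
WF (e₁ ⊕ e₂) = WF e₁ × WF e₂
WF ∅ = ⊤
WF (μ x ∙ e) = Guarded e × WF e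
WF (lit L b) = ⊤
WF l⟨ e ⟩ = WF e
WF r⟨ e ⟩ = WF e
WF l[ e ] = WF e
WF r[ e ] = WF e
WF (app a e) = WF e
WF ⟪ e ⟫ = WF e

data Scoped (Γ : List Var) : Exp → Set where
  s-var : ∀ {x} → Any (x ≡_) Γ → Scoped Γ (var x)
  s-⊕   : ∀ {e₁ e₂} → Scoped Γ e₁ → Scoped Γ e₂ → Scoped Γ (e₁ ⊕ e₂)
  s-∅   : Scoped Γ ∅
  s-μ   : ∀ {x e} → Scoped (x ∷ Γ) e → Scoped Γ (μ x ∙ e)
  s-lit : ∀ {L b} → Scoped Γ (lit L b)
  s-l⟨⟩ : ∀ {e} → Scoped Γ e → Scoped Γ l⟨ e ⟩
  s-r⟨⟩ : ∀ {e} → Scoped Γ e → Scoped Γ r⟨ e ⟩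
  s-l[] : ∀ {e} → Scoped Γ e → Scoped Γ l[ e ]
  s-r[] : ∀ {e} → Scoped Γ e → Scoped Γ r[ e ]
  s-app : ∀ {n} {a : Fin n} {e} → Scoped Γ e → Scoped Γ (app a e)
  s-set : ∀ {e} → Scoped Γ e → Scoped Γ ⟪ e ⟫

Closed : Exp → Set
Closed = Scoped []

infix 3 ⊢_∶_◁_
data ⊢_∶_◁_ : Exp → NDF → NDF → Set where
  t-∅   : ∀ {F G} → ⊢ ∅ ∶ F ◁ G
  t-lit : ∀ {L b G} → ⊢ lit L b ∶ B L ◁ G
  t-var : ∀ {x G} → ⊢ var x ∶ G ◁ G
  t-μ   : ∀ {x e G} → ⊢ e ∶ G ◁ G → ⊢ μ x ∙ e ∶ G ◁ G
  t-⊕   : ∀ {e₁ e₂ F G} → ⊢ e₁ ∶ F ◁ G → ⊢ e₂ ∶ F ◁ G → ⊢ e₁ ⊕ e₂ ∶ F ◁ G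
  t-Id  : ∀ {e G} → ⊢ e ∶ G ◁ G → ⊢ e ∶ Id ◁ G
  t-l⟨⟩ : ∀ {e F₁ F₂ G} → ⊢ e ∶ F₁ ◁ G → ⊢ l⟨ e ⟩ ∶ F₁ ⊠ F₂ ◁ G
  t-r⟨⟩ : ∀ {e F₁ F₂ G} → ⊢ e ∶ F₂ ◁ G → ⊢ r⟨ e ⟩ ∶ F₁ ⊠ F₂ ◁ G
  t-l[] : ∀ {e F₁ F₂ G} → ⊢ e ∶ F₁ ◁ G → ⊢ l[ e ] ∶ F₁ +̂ F₂ ◁ G
  t-r[] : ∀ {e F₁ F₂ G} → ⊢ e ∶ F₂ ◁ G → ⊢ r[ e ] ∶ F₁ +̂ F₂ ◁ G
  t-app : ∀ {n} {a : Fin n} {e F G} → ⊢ e ∶ F ◁ G → ⊢ app a e ∶ F ^F n ◁ G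
  t-set : ∀ {e F G} → ⊢ e ∶ F ◁ G → ⊢ ⟪ e ⟫ ∶ 𝒫 F ◁ G

ExpG : NDF → Exp → Set
ExpG G e = WF e × Closed e × (⊢ e ∶ G ◁ G)

data Cl (G : NDF) (R : Exp → Exp → Set) : Exp → Exp → Set where
  cl-R     : ∀ {e e'} → R e e' → Cl G R e e'
  cl-id    : ∀ {e} → ExpG G e → Cl G R e e
  cl-sym   : ∀ {e e'} → Cl G R e e' → Cl G R e' e
  cl-trans : ∀ {e e' e''} → Cl G R e e' → Cl G R e' e'' → Cl G R e e''

-- Reduced structured-expression terms (sort ExpStruct).  Semilattice
-- constants b are the expressions lit L b (Exp is a subsort of ExpStruct).

data SExp : Set where
  exp  : Exp → SExp
  pair : SExp → SExp → SExp
  k₁   : SExp → SExp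
  k₂   : SExp → SExp
  ⊥ₛ   : SExp
  ⊤ₛ   : SExp
  fun  : (n : ℕ) → (Fin n → SExp) → SExp
  set  : List SExp → SExp

⌜_⌝ : {F : NDF} → ⟦ F ⟧ Exp → SExp
⌜_⌝ {Id} e = exp e
⌜_⌝ {B L} b = exp (lit L b)
⌜_⌝ {F +̂ G} (κ₁ x) = k₁ (⌜_⌝ {F} x)
⌜_⌝ {F +̂ G} (κ₂ y) = k₂ (⌜_⌝ {G} y)
⌜_⌝ {F +̂ G} ⊥̂ = ⊥ₛ
⌜_⌝ {F +̂ G} ⊤̂ = ⊤ₛ
⌜_⌝ {F ⊠ G} (x , y) = pair (⌜_⌝ {F} x) (⌜_⌝ {G} y)
⌜_⌝ {F ^F n} g = fun n (λ a → ⌜_⌝ {F} (g a))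
⌜_⌝ {𝒫 F} xs = set (⌜⌝-list xs)
  where
  ⌜⌝-list : List (⟦ F ⟧ Exp) → List SExp
  ⌜⌝-list [] = []
  ⌜⌝-list (x ∷ xs) = ⌜_⌝ {F} x ∷ ⌜⌝-list xs

-- Derivable equations ⟨σ⟩ = ⟨σ'⟩ (sort Frozen) in E_G ∪ ⟨R⟩ under ⊢_NDF.
-- Since the equations of E_G only reduce defined operations, and no
-- operation takes Frozen arguments, the frozen equations between reduced
-- terms are generated by ⟨R⟩, equational reasoning and the NDF rules.

data _⊢NDF_≈_ (R : Exp → Exp → Set) : SExp → SExp → Set where
  ax     : ∀ {e e'} → R e e' → R ⊢NDF exp e ≈ exp e'
  refl   : ∀ {s} → R ⊢NDF s ≈ s
  sym    : ∀ {s s'} → R ⊢NDF s ≈ s' → R ⊢NDF s' ≈ s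
  trans  : ∀ {s s' s''} → R ⊢NDF s ≈ s' → R ⊢NDF s' ≈ s'' → R ⊢NDF s ≈ s''
  pair   : ∀ {s₁ s₁' s₂ s₂'} → R ⊢NDF s₁ ≈ s₁' → R ⊢NDF s₂ ≈ s₂' →
           R ⊢NDF pair s₁ s₂ ≈ pair s₁' s₂'
  k₁     : ∀ {s s'} → R ⊢NDF s ≈ s' → R ⊢NDF k₁ s ≈ k₁ s'
  k₂     : ∀ {s s'} → R ⊢NDF s ≈ s' → R ⊢NDF k₂ s ≈ k₂ s'
  fun    : ∀ {n f g} → (∀ a → R ⊢NDF f a ≈ g a) → R ⊢NDF fun n f ≈ fun n g
  set    : (ss ss' : List SExp)
           (ps : List (Fin (length ss) × Fin (length ss'))) →
           All (λ p → R ⊢NDF lookup ss (proj₁ p) ≈ lookup ss' (proj₂ p)) ps →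
           (∀ i → Any (λ p → proj₁ p ≡ i) ps) →
           (∀ j → Any (λ p → proj₂ p ≡ j) ps) →
           R ⊢NDF set ss ≈ set ss'

-- the empty relation (E_G without extra frozen equations)
NoEq : Exp → Exp → Set
NoEq _ _ = ⊥

-- Both sides are characterised by one relation ≅ on reduced terms: the
-- congruence generated by the NDF rules (finite sets compared à la
-- Egli–Milner) from the equivalence closure Q of R on expressions.  Since ≅
-- is an equivalence containing R, every derivation is sound for it; since it
-- is built from the NDF rules, it is derivable.  On reduced terms of
-- F-values, ≅ coincides with the lifting of cl(R_id): a lifting witness gives
-- ≅ componentwise, and ≅ unfolds into a witness as long as Q-related
-- G-expressions are cl(R_id)-related and Q-related semilattice constants are
-- equal.  The latter is where non-constancy of G enters: a constant that is a
-- G-expression forces G = B.  For constant G the only ingredient is B itself,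
-- and both sides just say σ = σ'.

module Submission where

open import Defs
open import Data.Empty using (⊥-elim)
open import Data.Fin using (Fin; zero; suc)
open import Data.List using (List; []; _∷_; _++_; length; lookup; map; tabulate)
open import Data.List.Membership.Propositional.Properties using (∈-lookup)
open import Data.List.Relation.Unary.All as All using (All; []; _∷_)
open import Data.List.Relation.Unary.Any as Any using (Any; here; there)
import Data.List.Relation.Unary.All.Properties as Allₚ
import Data.List.Relation.Unary.Any.Properties as Anyₚ
open import Data.Product using (Σ; _×_; _,_; proj₁; proj₂; map₁)
open import Data.Unit using (tt)
open import Function.Base using (id; flip; _∘_)
open import Function.Bundles using (_⇔_; mk⇔)
open import Relation.Nullary using (¬_)
open import Relation.Binary.Structures using (IsEquivalence)
open import Relation.Binary.Construct.Closure.Equivalence as EqClosure using (EqClosure)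
open import Relation.Binary.Construct.Closure.ReflexiveTransitive using (ε; _◅_; _◅◅_)
open import Relation.Binary.Construct.Closure.Symmetric using (fwd; bwd)
open import Relation.Binary.PropositionalEquality as ≡ using (_≡_; refl)

private
  variable
    A A' Y Y' X Z : Set
    xs : List A
    ys : List Y
    S T : A → Y → Set

Covers : (A → Y → Set) → List A → List Y → Set
Covers S xs ys = All (λ x → Any (S x) ys) xs

EgliMilner : (A → Y → Set) → List A → List Y → Set
EgliMilner S xs ys = Covers S xs ys × Covers (flip S) ys xs

Matching : (A → Y → Set) → List A → List Y → Set
Matching S xs ys =
  Σ (Fin (length xs) → Fin (length ys)) λ f → ∀ i → S (lookup xs i) (lookup ys (f i))

covers⇒matching : Covers S xs ys → Matching S xs ys
covers⇒matching {S = S} {xs = xs} {ys = ys} u =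
  (λ i → Any.index (hit i)) , (λ i → Anyₚ.lookup-index (hit i))
  where
  hit : (i : Fin (length xs)) → Any (S (lookup xs i)) ys
  hit i = All.lookup u (∈-lookup i)

matching⇒covers : Matching S xs ys → Covers S xs ys
matching⇒covers {xs = []} _ = []
matching⇒covers {S = S} {xs = x ∷ xs} {ys = ys} (f , s) =
  Any.map (λ { refl → s zero }) (∈-lookup (f zero)) ∷ matching⇒covers (f ∘ suc , s ∘ suc)

covering⇒choice : {I J : Set} {T : I → J → Set} (key : X → I) (val : X → J) {ps : List X} →
  All (λ p → T (key p) (val p)) ps → (∀ i → Any (λ p → key p ≡ i) ps) →
  Σ (I → J) λ f → ∀ i → T i (f i)
covering⇒choice {T = T} key val ts cover =
  (λ i → val (Any.lookup (cover i))) , (λ i → at (All.lookupAny ts (cover i)))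
  where
  at : ∀ {i p} → T (key p) (val p) × key p ≡ i → T i (val p)
  at (t , refl) = t

collect : {U : Z → Set} {T : X → Z → Set} {xs : List X} →
  All (λ x → Σ Z λ z → T x z × U z) xs →
  Σ (List Z) λ zs → All (λ z → Any (λ x → T x z) xs × U z) zs × All (λ x → Any (T x) zs) xs
collect [] = [] , [] , []
collect ((z , t , u) ∷ ws) =
  let zs , back , forth = collect ws
  in z ∷ zs , (here t , u) ∷ All.map (map₁ there) back , here t ∷ All.map there forth

EgliMilner-mono : (∀ {x y} → S x y → T x y) → EgliMilner S xs ys → EgliMilner T xs ys
EgliMilner-mono h (u , v) = All.map (Any.map h) u , All.map (Any.map h) v

Any-restrict : {P R R' : Y → Set} → All P ys → (∀ {y} → P y → R y → R' y) → Any R ys → Any R' ys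
Any-restrict (p ∷ _) h (here r) = here (h p r)
Any-restrict (_ ∷ ps) h (there a) = there (Any-restrict ps h a)

Covers-restrict : {P : A → Set} {P' : Y → Set} →
  (∀ {x y} → P x → P' y → S x y → T x y) →
  All P xs → All P' ys → Covers S xs ys → Covers T xs ys
Covers-restrict h pxs pys u = All.zipWith (λ (px , a) → Any-restrict pys (h px) a) (pxs , u)

EgliMilner-restrict : {P : A → Set} {P' : Y → Set} →
  (∀ {x y} → P x → P' y → S x y → T x y) →
  All P xs → All P' ys → EgliMilner S xs ys → EgliMilner T xs ys
EgliMilner-restrict h pxs pys (u , v) =
  Covers-restrict h pxs pys u , Covers-restrict (λ py px → h px py) pys pxs v

EgliMilner-diagonal : {R : A → A → Set} → (∀ x → R x x) → EgliMilner R xs xs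
EgliMilner-diagonal r = diagonal r , diagonal r
  where
  diagonal : ∀ {R : A → A → Set} {xs} → (∀ x → R x x) → Covers R xs xs
  diagonal r = All.tabulate (Any.map (λ { refl → r _ }))

EgliMilner-mapˡ : {f : A' → A} → EgliMilner (λ x y → S (f x) y) xs ys → EgliMilner S (map f xs) ys
EgliMilner-mapˡ (u , v) = Allₚ.map⁺ u , All.map Anyₚ.map⁺ v

EgliMilner-mapʳ : {g : Y' → Y} → EgliMilner (λ x y → S x (g y)) xs ys → EgliMilner S xs (map g ys)
EgliMilner-mapʳ (u , v) = All.map Anyₚ.map⁺ u , Allₚ.map⁺ v

EgliMilner-map⁻ : {f : A' → A} {g : Y' → Y} →
  EgliMilner S (map f xs) (map g ys) → EgliMilner (λ x y → S (f x) (g y)) xs ys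
EgliMilner-map⁻ (u , v) = All.map Anyₚ.map⁻ (Allₚ.map⁻ u) , All.map Anyₚ.map⁻ (Allₚ.map⁻ v)

set-injective : {ss ss' : List SExp} → SExp.set ss ≡ set ss' → ss ≡ ss'
set-injective refl = refl

⌜⌝-𝒫 : ∀ {F} (xs : List (⟦ F ⟧ Exp)) → ⌜_⌝ {𝒫 F} xs ≡ set (map (⌜_⌝ {F}) xs)
⌜⌝-𝒫 [] = refl
⌜⌝-𝒫 {F} (x ∷ xs) = ≡.cong (λ ss → set (⌜_⌝ {F} x ∷ ss)) (set-injective (⌜⌝-𝒫 xs))

mapF-𝒫 : ∀ F {X Y} (f : X → Y) (zs : List (⟦ F ⟧ X)) → mapF (𝒫 F) f zs ≡ map (mapF F f) zs
mapF-𝒫 F f [] = refl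
mapF-𝒫 F f (z ∷ zs) = ≡.cong (mapF F f z ∷_) (mapF-𝒫 F f zs)

set-by-matchings : ∀ {R ss ss'} →
  Matching (R ⊢NDF_≈_) ss ss' → Matching (flip (R ⊢NDF_≈_)) ss' ss → R ⊢NDF set ss ≈ set ss'
set-by-matchings {ss = ss} {ss'} (f , u) (g , v) =
  set ss ss' (forth ++ back)
    (Allₚ.++⁺ (Allₚ.tabulate⁺ u) (Allₚ.tabulate⁺ v))
    (λ i → Anyₚ.++⁺ˡ (Anyₚ.tabulate⁺ i refl))
    (λ j → Anyₚ.++⁺ʳ forth (Anyₚ.tabulate⁺ j refl))
  where
  forth back : List (Fin (length ss) × Fin (length ss'))
  forth = tabulate (λ i → i , f i)
  back = tabulate (λ j → g j , j)

exp-derivable-isEquivalence : ∀ {R} → IsEquivalence (λ e e' → R ⊢NDF exp e ≈ exp e')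
exp-derivable-isEquivalence = record { refl = refl ; sym = sym ; trans = trans }

Graph : (Exp → Exp → Set) → Set
Graph C = Σ (Exp × Exp) λ p → C (proj₁ p) (proj₂ p)

π₁ π₂ : ∀ {C} → Graph C → Exp
π₁ p = proj₁ (proj₁ p)
π₂ p = proj₂ (proj₁ p)

lifting-𝒫 : ∀ {C} F {xs ys : List (⟦ F ⟧ Exp)} → EgliMilner (Lifting F C) xs ys → Lifting (𝒫 F) C xs ys
-- The witness lists one lifting witness per element of xs, then one per element of ys.
lifting-𝒫 {C} F {xs} {ys} (u , v) =
  let zs₁ , in₁ , cov₁ = collect (All.map forth u)
      zs₂ , in₂ , cov₂ = collect (All.map back v)
  in zs₁ ++ zs₂ ,
     projection π₁ (Allₚ.++⁺ (All.map proj₁ in₁) (All.map proj₂ in₂) , All.map Anyₚ.++⁺ˡ cov₁) ,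
     projection π₂ (Allₚ.++⁺ (All.map proj₂ in₁) (All.map proj₁ in₂) , All.map (Anyₚ.++⁺ʳ zs₁) cov₂)
  where
  p₁ p₂ : ⟦ F ⟧ (Graph C) → ⟦ F ⟧ Exp
  p₁ = mapF F π₁
  p₂ = mapF F π₂

  forth : ∀ {x ys} → Any (Lifting F C x) ys →
          Σ (⟦ F ⟧ (Graph C)) λ z → EqF F (p₁ z) x × Any (EqF F (p₂ z)) ys
  forth (here (z , e , e')) = z , e , here e'
  forth (there a) = let z , e , a' = forth a in z , e , there a'

  back : ∀ {y xs} → Any (λ x → Lifting F C x y) xs →
         Σ (⟦ F ⟧ (Graph C)) λ z → EqF F (p₂ z) y × Any (λ x → EqF F (p₁ z) x) xs
  back (here (z , e , e')) = z , e' , here e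
  back (there a) = let z , e' , a' = back a in z , e' , there a'

  projection : (π : Graph C → Exp) {zs : List (⟦ F ⟧ (Graph C))} {ws : List (⟦ F ⟧ Exp)} →
    EgliMilner (λ z w → EqF F (mapF F π z) w) zs ws → EqF (𝒫 F) (mapF (𝒫 F) π zs) ws
  projection π {zs} e rewrite mapF-𝒫 F π zs = EgliMilner-mapˡ e

module Congruence (Q : Exp → Exp → Set) where

  infix 4 _≅_

  data _≅_ : SExp → SExp → Set where
    exp  : ∀ {e e'} → Q e e' → exp e ≅ exp e'
    pair : ∀ {s₁ s₁' s₂ s₂'} → s₁ ≅ s₁' → s₂ ≅ s₂' → pair s₁ s₂ ≅ pair s₁' s₂'
    k₁   : ∀ {s s'} → s ≅ s' → k₁ s ≅ k₁ s'
    k₂   : ∀ {s s'} → s ≅ s' → k₂ s ≅ k₂ s'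
    ⊥ₛ   : ⊥ₛ ≅ ⊥ₛ
    ⊤ₛ   : ⊤ₛ ≅ ⊤ₛ
    fun  : ∀ {n f g} → (∀ a → f a ≅ g a) → fun n f ≅ fun n g
    -- Sets are matched by index maps rather than All/Any so that ≅-sym and
    -- ≅-trans are structurally recursive.
    set  : ∀ {ss ss'} → Matching _≅_ ss ss' → Matching (flip _≅_) ss' ss → set ss ≅ set ss'

  ≅-at : (F : NDF) → ⟦ F ⟧ Exp → ⟦ F ⟧ Exp → Set
  ≅-at F x y = ⌜_⌝ {F} x ≅ ⌜_⌝ {F} y

  syntax ≅-at F x y = x ≅[ F ] y

  ≅-set⁺ : ∀ {ss ss'} → EgliMilner _≅_ ss ss' → set ss ≅ set ss'
  ≅-set⁺ (u , v) = set (covers⇒matching u) (covers⇒matching v)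

  ≅-set⁻ : ∀ {ss ss'} → set ss ≅ set ss' → EgliMilner _≅_ ss ss'
  ≅-set⁻ (set m m') = matching⇒covers m , matching⇒covers m'

  ≅-𝒫⁺ : ∀ {F} {xs ys : List (⟦ F ⟧ Exp)} → EgliMilner (≅-at F) xs ys → xs ≅[ 𝒫 F ] ys
  ≅-𝒫⁺ {xs = xs} {ys} e =
    ≡.subst₂ _≅_ (≡.sym (⌜⌝-𝒫 xs)) (≡.sym (⌜⌝-𝒫 ys)) (≅-set⁺ (EgliMilner-mapˡ (EgliMilner-mapʳ e)))

  ≅-𝒫⁻ : ∀ {F} {xs ys : List (⟦ F ⟧ Exp)} → xs ≅[ 𝒫 F ] ys → EgliMilner (≅-at F) xs ys
  ≅-𝒫⁻ {xs = xs} {ys} s =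
    EgliMilner-map⁻ (≅-set⁻ (≡.subst₂ _≅_ (⌜⌝-𝒫 xs) (⌜⌝-𝒫 ys) s))

  ≅⇒derivable : ∀ {R} → (∀ {e e'} → Q e e' → R ⊢NDF exp e ≈ exp e') →
                ∀ {s s'} → s ≅ s' → R ⊢NDF s ≈ s'
  ≅⇒derivable Q⇒R (exp q) = Q⇒R q
  ≅⇒derivable Q⇒R (pair s t) = pair (≅⇒derivable Q⇒R s) (≅⇒derivable Q⇒R t)
  ≅⇒derivable Q⇒R (k₁ s) = k₁ (≅⇒derivable Q⇒R s)
  ≅⇒derivable Q⇒R (k₂ s) = k₂ (≅⇒derivable Q⇒R s)
  ≅⇒derivable Q⇒R ⊥ₛ = refl
  ≅⇒derivable Q⇒R ⊤ₛ = refl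
  ≅⇒derivable Q⇒R (fun s) = fun (λ a → ≅⇒derivable Q⇒R (s a))
  ≅⇒derivable Q⇒R (set (f , u) (g , v)) =
    set-by-matchings (f , λ i → ≅⇒derivable Q⇒R (u i)) (g , λ j → ≅⇒derivable Q⇒R (v j))

  module _ (isEquivalence : IsEquivalence Q) where
    open IsEquivalence isEquivalence using () renaming (refl to Q-refl; sym to Q-sym; trans to Q-trans)

    mutual
      ≅-refl : ∀ s → s ≅ s
      ≅-refl (exp e) = exp Q-refl
      ≅-refl (pair s t) = pair (≅-refl s) (≅-refl t)
      ≅-refl (k₁ s) = k₁ (≅-refl s)
      ≅-refl (k₂ s) = k₂ (≅-refl s)
      ≅-refl ⊥ₛ = ⊥ₛ
      ≅-refl ⊤ₛ = ⊤ₛ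
      ≅-refl (fun n f) = fun (λ a → ≅-refl (f a))
      ≅-refl (set ss) = set (id , ≅-refl-lookup ss) (id , ≅-refl-lookup ss)

      ≅-refl-lookup : ∀ ss (i : Fin (length ss)) → lookup ss i ≅ lookup ss i
      ≅-refl-lookup (s ∷ _) zero = ≅-refl s
      ≅-refl-lookup (_ ∷ ss) (suc i) = ≅-refl-lookup ss i

    ≅-sym : ∀ {s s'} → s ≅ s' → s' ≅ s
    ≅-sym (exp q) = exp (Q-sym q)
    ≅-sym (pair s t) = pair (≅-sym s) (≅-sym t)
    ≅-sym (k₁ s) = k₁ (≅-sym s)
    ≅-sym (k₂ s) = k₂ (≅-sym s)
    ≅-sym ⊥ₛ = ⊥ₛ
    ≅-sym ⊤ₛ = ⊤ₛ
    ≅-sym (fun s) = fun (λ a → ≅-sym (s a))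
    ≅-sym (set (f , u) (g , v)) = set (g , λ j → ≅-sym (v j)) (f , λ i → ≅-sym (u i))

    ≅-trans : ∀ {s s' s''} → s ≅ s' → s' ≅ s'' → s ≅ s''
    ≅-trans (exp q) (exp q') = exp (Q-trans q q')
    ≅-trans (pair s t) (pair s' t') = pair (≅-trans s s') (≅-trans t t')
    ≅-trans (k₁ s) (k₁ s') = k₁ (≅-trans s s')
    ≅-trans (k₂ s) (k₂ s') = k₂ (≅-trans s s')
    ≅-trans ⊥ₛ ⊥ₛ = ⊥ₛ
    ≅-trans ⊤ₛ ⊤ₛ = ⊤ₛ
    ≅-trans (fun s) (fun s') = fun (λ a → ≅-trans (s a) (s' a))
    ≅-trans (set (f , u) (g , v)) (set (f' , u') (g' , v')) =
      set (f' ∘ f , λ i → ≅-trans (u i) (u' (f i))) (g ∘ g' , λ k → ≅-trans (v (g' k)) (v' k))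

    mutual
      derivable⇒≅ : ∀ {R} → (∀ {e e'} → R e e' → Q e e') → ∀ {s s'} → R ⊢NDF s ≈ s' → s ≅ s'
      derivable⇒≅ R⇒Q (ax r) = exp (R⇒Q r)
      derivable⇒≅ R⇒Q refl = ≅-refl _
      derivable⇒≅ R⇒Q (sym d) = ≅-sym (derivable⇒≅ R⇒Q d)
      derivable⇒≅ R⇒Q (trans d d') = ≅-trans (derivable⇒≅ R⇒Q d) (derivable⇒≅ R⇒Q d')
      derivable⇒≅ R⇒Q (pair d d') = pair (derivable⇒≅ R⇒Q d) (derivable⇒≅ R⇒Q d')
      derivable⇒≅ R⇒Q (k₁ d) = k₁ (derivable⇒≅ R⇒Q d)
      derivable⇒≅ R⇒Q (k₂ d) = k₂ (derivable⇒≅ R⇒Q d)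
      derivable⇒≅ R⇒Q (fun d) = fun (λ a → derivable⇒≅ R⇒Q (d a))
      derivable⇒≅ R⇒Q (set ss ss' ps ds cover cover') =
        set (covering⇒choice {T = λ i j → lookup ss i ≅ lookup ss' j} proj₁ proj₂ ds≅ cover)
            (covering⇒choice {T = λ j i → lookup ss i ≅ lookup ss' j} proj₂ proj₁ ds≅ cover')
        where ds≅ = derivable⇒≅-All R⇒Q ds

      derivable⇒≅-All : ∀ {R} → (∀ {e e'} → R e e' → Q e e') →
        {l r : X → SExp} {ps : List X} → All (λ p → R ⊢NDF l p ≈ r p) ps → All (λ p → l p ≅ r p) ps
      derivable⇒≅-All R⇒Q [] = []
      derivable⇒≅-All R⇒Q (d ∷ ds) = derivable⇒≅ R⇒Q d ∷ derivable⇒≅-All R⇒Q ds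

    eqF⇒≅ : ∀ F {a b : ⟦ F ⟧ Exp} → EqF F a b → a ≅[ F ] b
    eqF⇒≅ Id refl = exp Q-refl
    eqF⇒≅ (B L) refl = exp Q-refl
    eqF⇒≅ (F +̂ H) {κ₁ _} {κ₁ _} e = k₁ (eqF⇒≅ F e)
    eqF⇒≅ (F +̂ H) {κ₂ _} {κ₂ _} e = k₂ (eqF⇒≅ H e)
    eqF⇒≅ (F +̂ H) {⊥̂} {⊥̂} _ = ⊥ₛ
    eqF⇒≅ (F +̂ H) {⊤̂} {⊤̂} _ = ⊤ₛ
    eqF⇒≅ (F +̂ H) {κ₁ _} {κ₂ _} ()
    eqF⇒≅ (F +̂ H) {κ₁ _} {⊥̂} ()
    eqF⇒≅ (F +̂ H) {κ₁ _} {⊤̂} ()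
    eqF⇒≅ (F +̂ H) {κ₂ _} {κ₁ _} ()
    eqF⇒≅ (F +̂ H) {κ₂ _} {⊥̂} ()
    eqF⇒≅ (F +̂ H) {κ₂ _} {⊤̂} ()
    eqF⇒≅ (F +̂ H) {⊥̂} {κ₁ _} ()
    eqF⇒≅ (F +̂ H) {⊥̂} {κ₂ _} ()
    eqF⇒≅ (F +̂ H) {⊥̂} {⊤̂} ()
    eqF⇒≅ (F +̂ H) {⊤̂} {κ₁ _} ()
    eqF⇒≅ (F +̂ H) {⊤̂} {κ₂ _} ()
    eqF⇒≅ (F +̂ H) {⊤̂} {⊥̂} ()
    eqF⇒≅ (F ⊠ H) (e , e') = pair (eqF⇒≅ F e) (eqF⇒≅ H e')
    eqF⇒≅ (F ^F n) e = fun (λ a → eqF⇒≅ F (e a))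
    eqF⇒≅ (𝒫 F) e = ≅-𝒫⁺ (EgliMilner-mono (eqF⇒≅ F) e)

    module _ {C : Exp → Exp → Set} (C⇒Q : ∀ {e e'} → C e e' → Q e e') where

      ≅-projections : ∀ F (z : ⟦ F ⟧ (Graph C)) → mapF F π₁ z ≅[ F ] mapF F π₂ z
      ≅-projections Id (_ , c) = exp (C⇒Q c)
      ≅-projections (B L) _ = exp Q-refl
      ≅-projections (F +̂ H) (κ₁ z) = k₁ (≅-projections F z)
      ≅-projections (F +̂ H) (κ₂ z) = k₂ (≅-projections H z)
      ≅-projections (F +̂ H) ⊥̂ = ⊥ₛ
      ≅-projections (F +̂ H) ⊤̂ = ⊤ₛ
      ≅-projections (F ⊠ H) (z , z') = pair (≅-projections F z) (≅-projections H z')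
      ≅-projections (F ^F n) z = fun (λ a → ≅-projections F (z a))
      ≅-projections (𝒫 F) zs
        rewrite mapF-𝒫 F π₁ zs | mapF-𝒫 F π₂ zs =
        ≅-𝒫⁺ (EgliMilner-mapˡ (EgliMilner-mapʳ (EgliMilner-diagonal (≅-projections F))))

      lifting⇒≅ : ∀ F {σ σ' : ⟦ F ⟧ Exp} → Lifting F C σ σ' → σ ≅[ F ] σ'
      lifting⇒≅ F (z , e , e') = ≅-trans (≅-sym (eqF⇒≅ F e)) (≅-trans (≅-projections F z) (eqF⇒≅ F e'))

  module _ {P : Exp → Set} {C : Exp → Exp → Set}
           (Q⇒C : ∀ {e e'} → P e → Q e e' → C e e')
           (Q-lit : ∀ {L b b'} → Q (lit L b) (lit L b') → b ≡ b') where

    ≅⇒lifting : ∀ F (σ σ' : ⟦ F ⟧ Exp) → AllF F P σ → AllF F P σ' → σ ≅[ F ] σ' → Lifting F C σ σ'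
    ≅⇒lifting Id e e' p _ (exp q) = ((e , e') , Q⇒C p q) , refl , refl
    ≅⇒lifting (B L) b b' _ _ (exp q) = b , refl , Q-lit q
    ≅⇒lifting (F +̂ H) (κ₁ x) (κ₁ y) p p' (k₁ s) =
      let z , e , e' = ≅⇒lifting F x y p p' s in κ₁ z , e , e'
    ≅⇒lifting (F +̂ H) (κ₂ x) (κ₂ y) p p' (k₂ s) =
      let z , e , e' = ≅⇒lifting H x y p p' s in κ₂ z , e , e'
    ≅⇒lifting (F +̂ H) ⊥̂ ⊥̂ _ _ _ = ⊥̂ , tt , tt
    ≅⇒lifting (F +̂ H) ⊤̂ ⊤̂ _ _ _ = ⊤̂ , tt , tt
    ≅⇒lifting (F +̂ H) (κ₁ _) (κ₂ _) _ _ ()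
    ≅⇒lifting (F +̂ H) (κ₁ _) ⊥̂ _ _ ()
    ≅⇒lifting (F +̂ H) (κ₁ _) ⊤̂ _ _ ()
    ≅⇒lifting (F +̂ H) (κ₂ _) (κ₁ _) _ _ ()
    ≅⇒lifting (F +̂ H) (κ₂ _) ⊥̂ _ _ ()
    ≅⇒lifting (F +̂ H) (κ₂ _) ⊤̂ _ _ ()
    ≅⇒lifting (F +̂ H) ⊥̂ (κ₁ _) _ _ ()
    ≅⇒lifting (F +̂ H) ⊥̂ (κ₂ _) _ _ ()
    ≅⇒lifting (F +̂ H) ⊥̂ ⊤̂ _ _ ()
    ≅⇒lifting (F +̂ H) ⊤̂ (κ₁ _) _ _ ()
    ≅⇒lifting (F +̂ H) ⊤̂ (κ₂ _) _ _ ()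
    ≅⇒lifting (F +̂ H) ⊤̂ ⊥̂ _ _ ()
    ≅⇒lifting (F ⊠ H) (x , y) (x' , y') (p , q) (p' , q') (pair s t) =
      let z , e , e' = ≅⇒lifting F x x' p p' s
          w , f , f' = ≅⇒lifting H y y' q q' t
      in (z , w) , (e , f) , (e' , f')
    ≅⇒lifting (F ^F n) f g p p' (fun s) =
      (λ a → proj₁ (at a)) , (λ a → proj₁ (proj₂ (at a))) , (λ a → proj₂ (proj₂ (at a)))
      where
      at : ∀ a → Lifting F C (f a) (g a)
      at a = ≅⇒lifting F (f a) (g a) (p a) (p' a) (s a)
    ≅⇒lifting (𝒫 F) xs ys p p' s =
      lifting-𝒫 F (EgliMilner-restrict (λ {x} {y} → ≅⇒lifting F x y) p p' (≅-𝒫⁻ s))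

◁-constant : ∀ {F L} → F ◁ B L → F ≡ B L
◁-constant ◁-refl = refl
◁-constant (◁-trans F◁G G◁B) with ◁-constant G◁B
... | refl = ◁-constant F◁G

lit-self-typed : ∀ {G L b} → ⊢ lit L b ∶ G ◁ G → G ≡ B L
lit-self-typed t-lit = refl
lit-self-typed (t-Id d) = lit-self-typed d

ExpG-lit⇒constant : ∀ {G L b} → ExpG G (lit L b) → IsConstant G
ExpG-lit⇒constant (_ , _ , d) = _ , lit-self-typed d

module _ {G : NDF} {R : Exp → Exp → Set} where

  Cl⇒EqClosure : ∀ {e e'} → Cl G R e e' → EqClosure R e e'
  Cl⇒EqClosure (cl-R r) = EqClosure.return r
  Cl⇒EqClosure (cl-id _) = ε
  Cl⇒EqClosure (cl-sym c) = EqClosure.symmetric R (Cl⇒EqClosure c)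
  Cl⇒EqClosure (cl-trans c c') = Cl⇒EqClosure c ◅◅ Cl⇒EqClosure c'

  module _ (R⊆ExpG : ∀ {e e'} → R e e' → ExpG G e × ExpG G e') where

    EqClosure⇒Cl : ∀ {e e'} → ExpG G e → EqClosure R e e' → Cl G R e e'
    EqClosure⇒Cl e∈ ε = cl-id e∈
    EqClosure⇒Cl _ (fwd r ◅ rs) = cl-trans (cl-R r) (EqClosure⇒Cl (proj₂ (R⊆ExpG r)) rs)
    EqClosure⇒Cl _ (bwd r ◅ rs) = cl-trans (cl-sym (cl-R r)) (EqClosure⇒Cl (proj₁ (R⊆ExpG r)) rs)

    EqClosure-lit : ¬ IsConstant G → ∀ {L b b'} → EqClosure R (lit L b) (lit L b') → b ≡ b'
    EqClosure-lit _ ε = refl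
    EqClosure-lit G-nonconstant (fwd r ◅ _) = ⊥-elim (G-nonconstant (ExpG-lit⇒constant (proj₁ (R⊆ExpG r))))
    EqClosure-lit G-nonconstant (bwd r ◅ _) = ⊥-elim (G-nonconstant (ExpG-lit⇒constant (proj₂ (R⊆ExpG r))))

EqClosure⇒derivable : ∀ {R e e'} → EqClosure R e e' → R ⊢NDF exp e ≈ exp e'
EqClosure⇒derivable = EqClosure.fold exp-derivable-isEquivalence ax

module _ where
  open Congruence _≡_

  NoEq-lit : ∀ {L b b'} → NoEq ⊢NDF exp (lit L b) ≈ exp (lit L b') → b ≡ b'
  NoEq-lit d with derivable⇒≅ ≡.isEquivalence (λ ()) d
  ... | exp refl = refl

lifting-constant : ∀ {F L C} → F ≡ B L → (σ σ' : ⟦ F ⟧ Exp) →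
  Lifting F C σ σ' ⇔ (NoEq ⊢NDF ⌜_⌝ {F} σ ≈ ⌜_⌝ {F} σ')
lifting-constant refl σ σ' = mk⇔ (λ { (_ , refl , refl) → refl }) (λ d → σ , refl , NoEq-lit d)

theorem2 : (G F : NDF) → F ◁ G →
    (R : Exp → Exp → Set) → (∀ {e e'} → R e e' → ExpG G e × ExpG G e') →
    (σ σ' : ⟦ F ⟧ Exp) → AllF F (ExpG G) σ → AllF F (ExpG G) σ' →
    (¬ IsConstant G →
       (Lifting F (Cl G R) σ σ' ⇔ (R ⊢NDF ⌜_⌝ {F} σ ≈ ⌜_⌝ {F} σ')))
    × ((L : FinSL) → G ≡ B L →
       (Lifting F (Cl G R) σ σ' ⇔ (NoEq ⊢NDF ⌜_⌝ {F} σ ≈ ⌜_⌝ {F} σ')))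
theorem2 G F F◁G R R⊆ExpG σ σ' σ∈ σ'∈ =
  (λ G-nonconstant → mk⇔
    (≅⇒derivable EqClosure⇒derivable ∘ lifting⇒≅ Q-isEquivalence Cl⇒EqClosure F)
    (≅⇒lifting (EqClosure⇒Cl R⊆ExpG) (EqClosure-lit R⊆ExpG G-nonconstant) F σ σ' σ∈ σ'∈
      ∘ derivable⇒≅ Q-isEquivalence EqClosure.return)) ,
  (λ L G≡B → lifting-constant (◁-constant (≡.subst (F ◁_) G≡B F◁G)) σ σ')
  where
  open Congruence (EqClosure R)
  Q-isEquivalence : IsEquivalence (EqClosure R)
  Q-isEquivalence = EqClosure.isEquivalence R
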